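{- Let $\mathbb{T}$ be a strong monad on a distributive category $\mathbf{C}$, $\Sigma$ a strong functor, and suppose that for every object $X$ the functor $T(X+\Sigma(-))$ has a final coalgebra $\mathrm{out}_X:T_\Sigma X\to T(X+\Sigma T_\Sigma X)$. Then $T_\Sigma$ is a functor (with action $T_\Sigma f=(\eta^{\nu}\circ f)^{\ddagger}$) and $\mathrm{out}:T_\Sigma\to T(\mathrm{Id}+\Sigma T_\Sigma)$ is a natural transformation. Moreover, for any functor $G:\mathbf{B}\to\mathbf{C}$, $\mathrm{out}_G:T_\Sigma G\to T(G+\Sigma T_\Sigma G)$ is a final coalgebra of the functor $F\mapsto T(G+\Sigma F)$ on the functor category $[\mathbf{B},\mathbf{C}]$.
   Context: $\mathbf{C}$ is a distributive category; a strong monad is a Kleisli triple $(T,\eta,(-)^{*})$ with a strength $\tau$ satisfying the usual laws; $\Sigma$ is a functor with strength $\rho_{X,Y}:X\times\Sigma Y\to\Sigma(X\times Y)$. $\eta^{\nu}:X\to T_\Sigma X$ is defined by $\mathrm{out}\circ\eta^{\nu}=\eta\circ\mathrm{inl}$, and for $f:X\to T_\Sigma Y$, $f^{\ddagger}:T_\Sigma X\to T_\Sigma Y$ is the unique morphism with $\mathrm{out}\circ f^{\ddagger}=[\mathrm{out}\circ f,\eta\circ\mathrm{inr}\circ\Sigma f^{\ddagger}]^{*}\circ\mathrm{out}$; these form a monad structure on $T_\Sigma$. -}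

module Defs where

-- Categories are setoid-enriched: each hom-set carries an equivalence _≈_,
-- and "equal morphisms" means _≈_-related morphisms.

open import Level using (Level; _⊔_) renaming (suc to lsuc)
open import Relation.Binary using (IsEquivalence)

record Category (o ℓ e : Level) : Set (lsuc (o ⊔ ℓ ⊔ e)) where
  infix  4 _≈_ _⇒_
  infixr 9 _∘_
  field
    Obj       : Set o
    _⇒_       : Obj → Obj → Set ℓ
    _≈_       : ∀ {A B} → (A ⇒ B) → (A ⇒ B) → Set e
    id        : ∀ {A} → A ⇒ A
    _∘_       : ∀ {A B C} → B ⇒ C → A ⇒ B → A ⇒ C
    equiv     : ∀ {A B} → IsEquivalence (_≈_ {A} {B})
    assoc     : ∀ {A B C D} {f : A ⇒ B} {g : B ⇒ C} {h : C ⇒ D} →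
                (h ∘ g) ∘ f ≈ h ∘ (g ∘ f)
    identityˡ : ∀ {A B} {f : A ⇒ B} → id ∘ f ≈ f
    identityʳ : ∀ {A B} {f : A ⇒ B} → f ∘ id ≈ f
    ∘-resp-≈  : ∀ {A B C} {f h : B ⇒ C} {g i : A ⇒ B} →
                f ≈ h → g ≈ i → f ∘ g ≈ h ∘ i

record IsFunctor {o ℓ e o′ ℓ′ e′} (C : Category o ℓ e) (D : Category o′ ℓ′ e′)
                 (F₀ : Category.Obj C → Category.Obj D)
                 (F₁ : ∀ {A B} → Category._⇒_ C A B → Category._⇒_ D (F₀ A) (F₀ B))
                 : Set (o ⊔ ℓ ⊔ e ⊔ ℓ′ ⊔ e′) where
  private
    module C = Category C
    module D = Category D
  field
    identity     : ∀ {A} → F₁ (C.id {A}) D.≈ D.id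
    homomorphism : ∀ {X Y Z} {f : X C.⇒ Y} {g : Y C.⇒ Z} →
                   F₁ (g C.∘ f) D.≈ F₁ g D.∘ F₁ f
    F-resp-≈     : ∀ {A B} {f g : A C.⇒ B} → f C.≈ g → F₁ f D.≈ F₁ g

record Functor {o ℓ e o′ ℓ′ e′} (C : Category o ℓ e) (D : Category o′ ℓ′ e′)
               : Set (o ⊔ ℓ ⊔ e ⊔ o′ ⊔ ℓ′ ⊔ e′) where
  field
    F₀        : Category.Obj C → Category.Obj D
    F₁        : ∀ {A B} → Category._⇒_ C A B → Category._⇒_ D (F₀ A) (F₀ B)
    isFunctor : IsFunctor C D F₀ F₁
  open IsFunctor isFunctor public

IsNatural : ∀ {o ℓ e o′ ℓ′ e′} (B : Category o ℓ e) (C : Category o′ ℓ′ e′)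
            (F₀ : Category.Obj B → Category.Obj C)
            (F₁ : ∀ {a b} → Category._⇒_ B a b → Category._⇒_ C (F₀ a) (F₀ b))
            (G₀ : Category.Obj B → Category.Obj C)
            (G₁ : ∀ {a b} → Category._⇒_ B a b → Category._⇒_ C (G₀ a) (G₀ b))
            (α : ∀ b → Category._⇒_ C (F₀ b) (G₀ b)) → Set (o ⊔ ℓ ⊔ e′)
IsNatural B C F₀ F₁ G₀ G₁ α =
  ∀ {a b} (k : Category._⇒_ B a b) →
  Category._≈_ C (Category._∘_ C (α b) (F₁ k)) (Category._∘_ C (G₁ k) (α a))

record DistributiveCategory (o ℓ e : Level) : Set (lsuc (o ⊔ ℓ ⊔ e)) where
  field
    category : Category o ℓ e
  open Category category public
  infixr 7 _×_
  infixr 6 _+_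
  field
    ⊤        : Obj
    !        : ∀ {A} → A ⇒ ⊤
    !-unique : ∀ {A} (f : A ⇒ ⊤) → ! ≈ f
    _×_      : Obj → Obj → Obj
    π₁       : ∀ {A B} → A × B ⇒ A
    π₂       : ∀ {A B} → A × B ⇒ B
    ⟨_,_⟩    : ∀ {A B C} → C ⇒ A → C ⇒ B → C ⇒ A × B
    project₁ : ∀ {A B C} {f : C ⇒ A} {g : C ⇒ B} → π₁ ∘ ⟨ f , g ⟩ ≈ f
    project₂ : ∀ {A B C} {f : C ⇒ A} {g : C ⇒ B} → π₂ ∘ ⟨ f , g ⟩ ≈ g
    ⟨⟩-unique : ∀ {A B C} {h : C ⇒ A × B} {f : C ⇒ A} {g : C ⇒ B} →
                π₁ ∘ h ≈ f → π₂ ∘ h ≈ g → ⟨ f , g ⟩ ≈ h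
    ⊥        : Obj
    ¡        : ∀ {A} → ⊥ ⇒ A
    ¡-unique : ∀ {A} (f : ⊥ ⇒ A) → ¡ ≈ f
    _+_      : Obj → Obj → Obj
    i₁       : ∀ {A B} → A ⇒ A + B
    i₂       : ∀ {A B} → B ⇒ A + B
    [_,_]    : ∀ {A B C} → A ⇒ C → B ⇒ C → A + B ⇒ C
    inject₁  : ∀ {A B C} {f : A ⇒ C} {g : B ⇒ C} → [ f , g ] ∘ i₁ ≈ f
    inject₂  : ∀ {A B C} {f : A ⇒ C} {g : B ⇒ C} → [ f , g ] ∘ i₂ ≈ g
    []-unique : ∀ {A B C} {h : A + B ⇒ C} {f : A ⇒ C} {g : B ⇒ C} →
                h ∘ i₁ ≈ f → h ∘ i₂ ≈ g → [ f , g ] ≈ h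

  infixr 8 _⁂_
  infixr 7 _+₁_

  _⁂_ : ∀ {A B C D} → A ⇒ B → C ⇒ D → A × C ⇒ B × D
  f ⁂ g = ⟨ f ∘ π₁ , g ∘ π₂ ⟩

  _+₁_ : ∀ {A B C D} → A ⇒ B → C ⇒ D → A + C ⇒ B + D
  f +₁ g = [ i₁ ∘ f , i₂ ∘ g ]

  assocʳ : ∀ {A B C} → (A × B) × C ⇒ A × (B × C)
  assocʳ = ⟨ π₁ ∘ π₁ , ⟨ π₂ ∘ π₁ , π₂ ⟩ ⟩

  distribute : ∀ {A B C} → A × B + A × C ⇒ A × (B + C)
  distribute = [ id ⁂ i₁ , id ⁂ i₂ ]

  distribute₀ : ∀ {A} → ⊥ ⇒ A × ⊥
  distribute₀ = ¡

  field
    distribute⁻¹  : ∀ {A B C} → A × (B + C) ⇒ A × B + A × C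
    distribute-isoˡ : ∀ {A B C} → distribute⁻¹ {A} {B} {C} ∘ distribute ≈ id
    distribute-isoʳ : ∀ {A B C} → distribute {A} {B} {C} ∘ distribute⁻¹ ≈ id
    distribute₀⁻¹  : ∀ {A} → A × ⊥ ⇒ ⊥
    distribute₀-isoˡ : ∀ {A} → distribute₀⁻¹ {A} ∘ distribute₀ ≈ id
    distribute₀-isoʳ : ∀ {A} → distribute₀ {A} ∘ distribute₀⁻¹ ≈ id

record StrongMonad {o ℓ e} (C : DistributiveCategory o ℓ e) : Set (o ⊔ ℓ ⊔ e) where
  open DistributiveCategory C
  infix 10 _*
  field
    T₀      : Obj → Obj
    η       : ∀ {X} → X ⇒ T₀ X
    _*      : ∀ {X Y} → X ⇒ T₀ Y → T₀ X ⇒ T₀ Y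
    *-resp-≈ : ∀ {X Y} {f g : X ⇒ T₀ Y} → f ≈ g → f * ≈ g *
    η*      : ∀ {X} → η {X} * ≈ id
    *-η     : ∀ {X Y} {f : X ⇒ T₀ Y} → f * ∘ η ≈ f
    *-assoc : ∀ {X Y Z} {f : X ⇒ T₀ Y} {g : Y ⇒ T₀ Z} → (g * ∘ f) * ≈ g * ∘ f *
    τ       : ∀ {X Y} → X × T₀ Y ⇒ T₀ (X × Y)
    τ-natural : ∀ {X X′ Y Y′} {f : X ⇒ X′} {g : Y ⇒ Y′} →
                τ ∘ (f ⁂ (η ∘ g) *) ≈ (η ∘ (f ⁂ g)) * ∘ τ
    τ-π₂    : ∀ {X Y} → (η ∘ π₂) * ∘ τ {X} {Y} ≈ π₂
    τ-assoc : ∀ {X Y Z} → (η ∘ assocʳ) * ∘ τ {X × Y} {Z} ≈ τ ∘ (id ⁂ τ) ∘ assocʳ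
    τ-η     : ∀ {X Y} → τ ∘ (id ⁂ η) ≈ η {X × Y}
    τ-*     : ∀ {X Y Z} {f : Y ⇒ T₀ Z} →
              τ ∘ (id {X} ⁂ f *) ≈ (τ ∘ (id ⁂ f)) * ∘ τ

  T₁ : ∀ {X Y} → X ⇒ Y → T₀ X ⇒ T₀ Y
  T₁ f = (η ∘ f) *

record StrongFunctor {o ℓ e} (C : DistributiveCategory o ℓ e) : Set (o ⊔ ℓ ⊔ e) where
  open DistributiveCategory C
  field
    functor : Functor category category
  open Functor functor public
  field
    ρ         : ∀ {X Y} → X × F₀ Y ⇒ F₀ (X × Y)
    ρ-natural : ∀ {X X′ Y Y′} {f : X ⇒ X′} {g : Y ⇒ Y′} →
                ρ ∘ (f ⁂ F₁ g) ≈ F₁ (f ⁂ g) ∘ ρ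
    ρ-π₂      : ∀ {X Y} → F₁ π₂ ∘ ρ {X} {Y} ≈ π₂
    ρ-assoc   : ∀ {X Y Z} → F₁ assocʳ ∘ ρ {X × Y} {Z} ≈ ρ ∘ (id ⁂ ρ) ∘ assocʳ

module _ {o ℓ e} (C : DistributiveCategory o ℓ e) (𝕋 : StrongMonad C)
         (𝕊 : StrongFunctor C) where
  open DistributiveCategory C
  open StrongMonad 𝕋
  private module S = StrongFunctor 𝕊

  record FinalCoalgebras : Set (o ⊔ ℓ ⊔ e) where
    field
      TΣ₀    : Obj → Obj
      out    : ∀ {X} → TΣ₀ X ⇒ T₀ (X + S.F₀ (TΣ₀ X))
      unfold : ∀ {X A} → A ⇒ T₀ (X + S.F₀ A) → A ⇒ TΣ₀ X
      unfold-commute : ∀ {X A} {a : A ⇒ T₀ (X + S.F₀ A)} →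
                       out ∘ unfold a ≈ T₁ (id +₁ S.F₁ (unfold a)) ∘ a
      unfold-unique  : ∀ {X A} {a : A ⇒ T₀ (X + S.F₀ A)} {h : A ⇒ TΣ₀ X} →
                       out ∘ h ≈ T₁ (id +₁ S.F₁ h) ∘ a → h ≈ unfold a

module Construction {o ℓ e} (C : DistributiveCategory o ℓ e) (𝕋 : StrongMonad C)
                    (𝕊 : StrongFunctor C) (ν : FinalCoalgebras C 𝕋 𝕊) where
  open DistributiveCategory C
  open StrongMonad 𝕋
  private module S = StrongFunctor 𝕊
  open FinalCoalgebras ν

  -- inverse of out (Lambek): the coalgebra morphism (H_X TΣX, H_X out) → (TΣX, out)
  out⁻¹ : ∀ {X} → T₀ (X + S.F₀ (TΣ₀ X)) ⇒ TΣ₀ X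
  out⁻¹ = unfold (T₁ (id +₁ S.F₁ out))

  -- η^ν : X → T_Σ X, the morphism with  out ∘ η^ν = η ∘ inl
  ηᵛ : ∀ {X} → X ⇒ TΣ₀ X
  ηᵛ = out⁻¹ ∘ η ∘ i₁

  -- f^‡ : T_Σ X → T_Σ Y, for f : X → T_Σ Y, the morphism with
  --   out ∘ f^‡ = [out ∘ f, η ∘ inr ∘ Σ f^‡]* ∘ out.
  _‡ : ∀ {X Y} → X ⇒ TΣ₀ Y → TΣ₀ X ⇒ TΣ₀ Y
  _‡ {X} {Y} f = unfold c ∘ i₂
    where
      c : TΣ₀ Y + TΣ₀ X ⇒ T₀ (Y + S.F₀ (TΣ₀ Y + TΣ₀ X))
      c = [ T₁ (id +₁ S.F₁ i₁) ∘ out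
          , [ T₁ (id +₁ S.F₁ i₁) ∘ out ∘ f , η ∘ i₂ ∘ S.F₁ i₂ ] * ∘ out ]

  TΣ₁ : ∀ {X Y} → X ⇒ Y → TΣ₀ X ⇒ TΣ₀ Y
  TΣ₁ f = (ηᵛ ∘ f) ‡

  OutNatural : Set (o ⊔ ℓ ⊔ e)
  OutNatural = ∀ {X Y} (f : X ⇒ Y) →
               out ∘ TΣ₁ f ≈ T₁ (f +₁ S.F₁ (TΣ₁ f)) ∘ out

  -- Objects of [B,C] are functors, morphisms are natural transformations,
  -- and two natural transformations are equal iff they are componentwise ≈.
  module _ {o′ ℓ′ e′} (B : Category o′ ℓ′ e′) (G : Functor B category) where
    private module B = Category B
    private module G = Functor G

    HG₀ : Functor B category → B.Obj → Obj
    HG₀ F b = T₀ (G.F₀ b + S.F₀ (Functor.F₀ F b))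

    HG₁ : (F : Functor B category) → ∀ {a b} → a B.⇒ b → HG₀ F a ⇒ HG₀ F b
    HG₁ F k = T₁ (G.F₁ k +₁ S.F₁ (Functor.F₁ F k))

    TΣG₀ : B.Obj → Obj
    TΣG₀ b = TΣ₀ (G.F₀ b)

    TΣG₁ : ∀ {a b} → a B.⇒ b → TΣG₀ a ⇒ TΣG₀ b
    TΣG₁ k = TΣ₁ (G.F₁ k)

    record Coalgebraᴳ : Set (o ⊔ ℓ ⊔ e ⊔ o′ ⊔ ℓ′ ⊔ e′) where
      field
        F        : Functor B category
        α        : ∀ b → Functor.F₀ F b ⇒ HG₀ F b
        α-natural : IsNatural B category (Functor.F₀ F) (Functor.F₁ F)
                              (HG₀ F) (HG₁ F) α

    record IsFinalCoalgebraᴳ (TΣG-functor : IsFunctor B category TΣG₀ TΣG₁)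
           : Set (lsuc (o ⊔ ℓ ⊔ e ⊔ o′ ⊔ ℓ′ ⊔ e′)) where
      TΣG : Functor B category
      TΣG = record { F₀ = TΣG₀ ; F₁ = TΣG₁ ; isFunctor = TΣG-functor }
      field
        outG-natural : IsNatural B category TΣG₀ TΣG₁ (HG₀ TΣG) (HG₁ TΣG)
                                 (λ b → out)
        unfoldᴳ         : (A : Coalgebraᴳ) → ∀ b →
                          Functor.F₀ (Coalgebraᴳ.F A) b ⇒ TΣG₀ b
        unfoldᴳ-natural : (A : Coalgebraᴳ) →
                          IsNatural B category
                            (Functor.F₀ (Coalgebraᴳ.F A)) (Functor.F₁ (Coalgebraᴳ.F A))
                            TΣG₀ TΣG₁ (unfoldᴳ A)
        unfoldᴳ-commute : (A : Coalgebraᴳ) → ∀ b →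
                          out ∘ unfoldᴳ A b
                            ≈ T₁ (id +₁ S.F₁ (unfoldᴳ A b)) ∘ Coalgebraᴳ.α A b
        unfoldᴳ-unique  : (A : Coalgebraᴳ)
                          (h : ∀ b → Functor.F₀ (Coalgebraᴳ.F A) b ⇒ TΣG₀ b) →
                          IsNatural B category
                            (Functor.F₀ (Coalgebraᴳ.F A)) (Functor.F₁ (Coalgebraᴳ.F A))
                            TΣG₀ TΣG₁ h →
                          (∀ b → out ∘ h b ≈ T₁ (id +₁ S.F₁ (h b)) ∘ Coalgebraᴳ.α A b) →
                          ∀ b → h b ≈ unfoldᴳ A b

module Submission where

-- Everything rests on one notion.  For coalgebras a : A → T(X + ΣA) and
-- b : B → T(Y + ΣB), a morphism h : A → B is a coalgebra morphism over
-- f : X → Y when  b ∘ h = T(f + Σh) ∘ a.  Such morphisms compose (over the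
-- composite) because (f, h) ↦ T(f + Σh) is a bifunctor, and a morphism over
-- f into the final coalgebra out is unique: it is the unfold of T(f + id) ∘ a.
-- From this we get unfold fusion, Lambek's lemma, and the defining equation
-- of (-)^‡.  The latter shows that T_Σ f = (η^ν ∘ f)^‡ is a morphism
-- out → out over f (naturality of out); uniqueness then yields the functor
-- laws for T_Σ, and also that T_Σ f ∘ unfold a = unfold (T(f + id) ∘ a).
-- Finality of out_G in [B, C] is componentwise finality of out: the only
-- new fact is that the componentwise unfolds are natural, which follows
-- from fusion and the last equation.

open import Defs
open import Data.Product using (Σ-syntax; _×_; _,_)
open import Relation.Binary using (IsEquivalence; Setoid)
import Relation.Binary.Reasoning.Setoid as SetoidReasoning

∘-isFunctor : ∀ {o ℓ e o′ ℓ′ e′ o″ ℓ″ e″}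
              {B : Category o ℓ e} {C : Category o′ ℓ′ e′} {D : Category o″ ℓ″ e″}
              (F : Functor B C) {G₀ : Category.Obj C → Category.Obj D}
              {G₁ : ∀ {x y} → Category._⇒_ C x y → Category._⇒_ D (G₀ x) (G₀ y)} →
              IsFunctor C D G₀ G₁ →
              IsFunctor B D (λ b → G₀ (Functor.F₀ F b)) (λ k → G₁ (Functor.F₁ F k))
∘-isFunctor {D = D} F G = record
  { identity     = D.Eq.trans (G.F-resp-≈ F.identity) G.identity
  ; homomorphism = D.Eq.trans (G.F-resp-≈ F.homomorphism) G.homomorphism
  ; F-resp-≈     = λ p → G.F-resp-≈ (F.F-resp-≈ p)
  }
  where
    module F = Functor F
    module G = IsFunctor G
    module D where
      open Category D public
      module Eq {x y} = IsEquivalence (equiv {x} {y})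

module Proof {o ℓ e} (C : DistributiveCategory o ℓ e) (𝕋 : StrongMonad C)
             (𝕊 : StrongFunctor C) (ν : FinalCoalgebras C 𝕋 𝕊) where
  open DistributiveCategory C hiding (_×_)
  open StrongMonad 𝕋
  module S = StrongFunctor 𝕊
  open FinalCoalgebras ν
  open Construction C 𝕋 𝕊 ν

  module Eq {A B : Obj} = IsEquivalence (equiv {A} {B})

  hom-setoid : Obj → Obj → Setoid ℓ e
  hom-setoid A B = record { Carrier = A ⇒ B ; _≈_ = _≈_ ; isEquivalence = equiv }

  module HomReasoning {A B : Obj} = SetoidReasoning (hom-setoid A B)
  open HomReasoning

  infixr 4 _⟩∘⟨_
  _⟩∘⟨_ : ∀ {A B D} {f h : B ⇒ D} {g i : A ⇒ B} → f ≈ h → g ≈ i → f ∘ g ≈ h ∘ i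
  _⟩∘⟨_ = ∘-resp-≈

  refl⟩∘⟨_ : ∀ {A B D} {f : B ⇒ D} {g i : A ⇒ B} → g ≈ i → f ∘ g ≈ f ∘ i
  refl⟩∘⟨ p = Eq.refl ⟩∘⟨ p

  _⟩∘⟨refl : ∀ {A B D} {f h : B ⇒ D} {g : A ⇒ B} → f ≈ h → f ∘ g ≈ h ∘ g
  p ⟩∘⟨refl = p ⟩∘⟨ Eq.refl

  ∘-[] : ∀ {A B D E} {h : D ⇒ E} {f : A ⇒ D} {g : B ⇒ D} →
         h ∘ [ f , g ] ≈ [ h ∘ f , h ∘ g ]
  ∘-[] = Eq.sym ([]-unique (Eq.trans assoc (refl⟩∘⟨ inject₁))
                           (Eq.trans assoc (refl⟩∘⟨ inject₂)))

  []-cong : ∀ {A B D} {f f′ : A ⇒ D} {g g′ : B ⇒ D} →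
            f ≈ f′ → g ≈ g′ → [ f , g ] ≈ [ f′ , g′ ]
  []-cong p q = Eq.sym ([]-unique (Eq.trans inject₁ p) (Eq.trans inject₂ q))

  +₁-cong : ∀ {A B D E} {f f′ : A ⇒ B} {g g′ : D ⇒ E} →
            f ≈ f′ → g ≈ g′ → f +₁ g ≈ f′ +₁ g′
  +₁-cong p q = []-cong (refl⟩∘⟨ p) (refl⟩∘⟨ q)

  +₁-∘ : ∀ {A B D A′ B′ D′} {a : B ⇒ D} {b : B′ ⇒ D′} {c : A ⇒ B} {d : A′ ⇒ B′} →
         (a +₁ b) ∘ (c +₁ d) ≈ (a ∘ c) +₁ (b ∘ d)
  +₁-∘ = Eq.trans ∘-[] ([]-cong (past inject₁) (past inject₂))
    where
      past : ∀ {A B D E G} {f : B ⇒ E} {i : D ⇒ B} {j : G ⇒ E} {g : D ⇒ G}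
               {c : A ⇒ D} → f ∘ i ≈ j ∘ g → f ∘ (i ∘ c) ≈ j ∘ (g ∘ c)
      past p = Eq.trans (Eq.sym assoc) (Eq.trans (p ⟩∘⟨refl) assoc)

  +₁-id : ∀ {A B} → id {A} +₁ id {B} ≈ id
  +₁-id = []-unique (Eq.trans identityˡ (Eq.sym identityʳ))
                    (Eq.trans identityˡ (Eq.sym identityʳ))

  T-resp : ∀ {X Y} {f g : X ⇒ Y} → f ≈ g → T₁ f ≈ T₁ g
  T-resp p = *-resp-≈ (refl⟩∘⟨ p)

  T-id : ∀ {X} → T₁ (id {X}) ≈ id
  T-id = Eq.trans (*-resp-≈ identityʳ) η*

  T-* : ∀ {X Y Z} {g : Y ⇒ Z} {h : X ⇒ T₀ Y} → T₁ g ∘ h * ≈ (T₁ g ∘ h) *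
  T-* = Eq.sym *-assoc

  T-hom : ∀ {X Y Z} {f : X ⇒ Y} {g : Y ⇒ Z} → T₁ g ∘ T₁ f ≈ T₁ (g ∘ f)
  T-hom {f = f} {g} = begin
    T₁ g ∘ T₁ f        ≈⟨ T-* ⟩
    (T₁ g ∘ (η ∘ f)) * ≈⟨ *-resp-≈ (Eq.sym assoc) ⟩
    ((T₁ g ∘ η) ∘ f) * ≈⟨ *-resp-≈ (*-η ⟩∘⟨refl) ⟩
    ((η ∘ g) ∘ f) *    ≈⟨ *-resp-≈ assoc ⟩
    T₁ (g ∘ f)         ∎

  -- The bifunctor K(X, A) = T(X + ΣA), whose partial functor K(X, -) is the
  -- functor H_X of the final coalgebras.

  K₁ : ∀ {X Y A B} → X ⇒ Y → A ⇒ B → T₀ (X + S.F₀ A) ⇒ T₀ (Y + S.F₀ B)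
  K₁ f h = T₁ (f +₁ S.F₁ h)

  K-resp : ∀ {X Y A B} {f f′ : X ⇒ Y} {h h′ : A ⇒ B} → f ≈ f′ → h ≈ h′ → K₁ f h ≈ K₁ f′ h′
  K-resp p q = T-resp (+₁-cong p (S.F-resp-≈ q))

  K-id : ∀ {X A} → K₁ (id {X}) (id {A}) ≈ id
  K-id = Eq.trans (T-resp (Eq.trans (+₁-cong Eq.refl S.identity) +₁-id)) T-id

  K-∘ : ∀ {X Y Z A B D} {g : Y ⇒ Z} {k : B ⇒ D} {f : X ⇒ Y} {h : A ⇒ B} →
        K₁ g k ∘ K₁ f h ≈ K₁ (g ∘ f) (k ∘ h)
  K-∘ = Eq.trans T-hom (T-resp (Eq.trans +₁-∘ (+₁-cong Eq.refl (Eq.sym S.homomorphism))))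

  K-split : ∀ {X Y A B} {f : X ⇒ Y} {h : A ⇒ B} → K₁ f h ≈ K₁ id h ∘ K₁ f id
  K-split = Eq.sym (Eq.trans K-∘ (K-resp identityˡ identityʳ))

  CoalgebraMorphism : ∀ {X Y A B} → A ⇒ T₀ (X + S.F₀ A) → X ⇒ Y →
                      B ⇒ T₀ (Y + S.F₀ B) → A ⇒ B → Set e
  CoalgebraMorphism a f b h = b ∘ h ≈ K₁ f h ∘ a

  morphism-id : ∀ {X A} {a : A ⇒ T₀ (X + S.F₀ A)} → CoalgebraMorphism a id a id
  morphism-id = Eq.trans identityʳ (Eq.sym (Eq.trans (K-id ⟩∘⟨refl) identityˡ))

  morphism-∘ : ∀ {X Y Z A B D} {a : A ⇒ T₀ (X + S.F₀ A)} {b : B ⇒ T₀ (Y + S.F₀ B)}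
                 {c : D ⇒ T₀ (Z + S.F₀ D)} {f : X ⇒ Y} {g : Y ⇒ Z} {h : A ⇒ B} {k : B ⇒ D} →
               CoalgebraMorphism b g c k → CoalgebraMorphism a f b h →
               CoalgebraMorphism a (g ∘ f) c (k ∘ h)
  morphism-∘ {a = a} {b} {c} {f} {g} {h} {k} ck bh = begin
    c ∘ (k ∘ h)           ≈⟨ Eq.sym assoc ⟩
    (c ∘ k) ∘ h           ≈⟨ ck ⟩∘⟨refl ⟩
    (K₁ g k ∘ b) ∘ h      ≈⟨ assoc ⟩
    K₁ g k ∘ (b ∘ h)      ≈⟨ refl⟩∘⟨ bh ⟩
    K₁ g k ∘ (K₁ f h ∘ a) ≈⟨ Eq.sym assoc ⟩
    (K₁ g k ∘ K₁ f h) ∘ a ≈⟨ K-∘ ⟩∘⟨refl ⟩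
    K₁ (g ∘ f) (k ∘ h) ∘ a ∎

  morphism-resp : ∀ {X Y A B} {a : A ⇒ T₀ (X + S.F₀ A)} {b : B ⇒ T₀ (Y + S.F₀ B)}
                    {f f′ : X ⇒ Y} {h : A ⇒ B} →
                  f ≈ f′ → CoalgebraMorphism a f b h → CoalgebraMorphism a f′ b h
  morphism-resp p bh = Eq.trans bh (K-resp p Eq.refl ⟩∘⟨refl)

  morphism-rebase : ∀ {X Y A B} {a : A ⇒ T₀ (X + S.F₀ A)} {b : B ⇒ T₀ (Y + S.F₀ B)}
                      {f : X ⇒ Y} {h : A ⇒ B} →
                    CoalgebraMorphism a f b h → CoalgebraMorphism (K₁ f id ∘ a) id b h
  morphism-rebase bh = Eq.trans bh (Eq.trans (K-split ⟩∘⟨refl) assoc)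

  morphism-unique : ∀ {X Y A} {a : A ⇒ T₀ (X + S.F₀ A)} {f : X ⇒ Y} {h : A ⇒ TΣ₀ Y} →
                    CoalgebraMorphism a f out h → h ≈ unfold (K₁ f id ∘ a)
  morphism-unique oh = unfold-unique (morphism-rebase oh)

  unfold-out : ∀ {X} → unfold (out {X}) ≈ id
  unfold-out = Eq.sym (unfold-unique morphism-id)

  unfold-fusion : ∀ {X A B} {a : A ⇒ T₀ (X + S.F₀ A)} {b : B ⇒ T₀ (X + S.F₀ B)} {k : A ⇒ B} →
                  CoalgebraMorphism a id b k → unfold b ∘ k ≈ unfold a
  unfold-fusion bk = unfold-unique (morphism-resp identityˡ (morphism-∘ unfold-commute bk))

  out⁻¹∘out : ∀ {X} → out⁻¹ {X} ∘ out ≈ id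
  out⁻¹∘out = Eq.trans (unfold-fusion Eq.refl) unfold-out

  out∘out⁻¹ : ∀ {X} → out {X} ∘ out⁻¹ ≈ id
  out∘out⁻¹ = begin
    out ∘ out⁻¹                ≈⟨ unfold-commute ⟩
    K₁ id out⁻¹ ∘ K₁ id out    ≈⟨ K-∘ ⟩
    K₁ (id ∘ id) (out⁻¹ ∘ out) ≈⟨ K-resp identityˡ out⁻¹∘out ⟩
    K₁ id id                   ≈⟨ K-id ⟩
    id                         ∎

  out∘ηᵛ : ∀ {X} → out ∘ ηᵛ {X} ≈ η ∘ i₁
  out∘ηᵛ = Eq.trans (Eq.sym assoc) (Eq.trans (out∘out⁻¹ ⟩∘⟨refl) identityˡ)

  -- The coalgebra on T_Σ Y + T_Σ X whose unfold, restricted along inr, is f^‡: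
  -- it behaves as out on the left summand and runs f through out on the right.
  ‡-coalgebra : ∀ {X Y} → X ⇒ TΣ₀ Y → TΣ₀ Y + TΣ₀ X ⇒ T₀ (Y + S.F₀ (TΣ₀ Y + TΣ₀ X))
  ‡-coalgebra f = [ K₁ id i₁ ∘ out , [ K₁ id i₁ ∘ out ∘ f , η ∘ i₂ ∘ S.F₁ i₂ ] * ∘ out ]

  -- On the left summand the unfold is the identity, since inl is a coalgebra
  -- morphism from out.
  ‡-unfold-inl : ∀ {X Y} (f : X ⇒ TΣ₀ Y) → unfold (‡-coalgebra f) ∘ i₁ ≈ id
  ‡-unfold-inl f = Eq.trans (unfold-fusion inject₁) unfold-out

  ‡-equation : ∀ {X Y} (f : X ⇒ TΣ₀ Y) →
               out ∘ f ‡ ≈ [ out ∘ f , η ∘ i₂ ∘ S.F₁ (f ‡) ] * ∘ out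
  ‡-equation f = begin
    out ∘ (u ∘ i₂)                                          ≈⟨ Eq.sym assoc ⟩
    (out ∘ u) ∘ i₂                                          ≈⟨ unfold-commute ⟩∘⟨refl ⟩
    (K₁ id u ∘ ‡-coalgebra f) ∘ i₂                          ≈⟨ assoc ⟩
    K₁ id u ∘ (‡-coalgebra f ∘ i₂)                          ≈⟨ refl⟩∘⟨ inject₂ ⟩
    K₁ id u ∘ ([ K₁ id i₁ ∘ out ∘ f , η ∘ i₂ ∘ S.F₁ i₂ ] * ∘ out) ≈⟨ Eq.sym assoc ⟩
    (K₁ id u ∘ [ K₁ id i₁ ∘ out ∘ f , η ∘ i₂ ∘ S.F₁ i₂ ] *) ∘ out ≈⟨ T-* ⟩∘⟨refl ⟩
    (K₁ id u ∘ [ K₁ id i₁ ∘ out ∘ f , η ∘ i₂ ∘ S.F₁ i₂ ]) * ∘ out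
      ≈⟨ *-resp-≈ (Eq.trans ∘-[] ([]-cong left right)) ⟩∘⟨refl ⟩
    [ out ∘ f , η ∘ i₂ ∘ S.F₁ (u ∘ i₂) ] * ∘ out              ∎
    where
      u = unfold (‡-coalgebra f)

      -- the left branch: K(id, u ∘ inl) is the identity
      left : K₁ id u ∘ (K₁ id i₁ ∘ out ∘ f) ≈ out ∘ f
      left = begin
        K₁ id u ∘ (K₁ id i₁ ∘ out ∘ f) ≈⟨ Eq.sym assoc ⟩
        (K₁ id u ∘ K₁ id i₁) ∘ out ∘ f ≈⟨ Eq.trans K-∘ (K-resp identityˡ (‡-unfold-inl f)) ⟩∘⟨refl ⟩
        K₁ id id ∘ out ∘ f             ≈⟨ K-id ⟩∘⟨refl ⟩
        id ∘ out ∘ f                   ≈⟨ identityˡ ⟩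
        out ∘ f                        ∎

      -- the right branch: the pure step η ∘ inr commutes with K(id, u)
      right : K₁ id u ∘ (η ∘ i₂ ∘ S.F₁ i₂) ≈ η ∘ i₂ ∘ S.F₁ (u ∘ i₂)
      right = begin
        K₁ id u ∘ (η ∘ i₂ ∘ S.F₁ i₂)          ≈⟨ Eq.sym assoc ⟩
        (K₁ id u ∘ η) ∘ i₂ ∘ S.F₁ i₂          ≈⟨ *-η ⟩∘⟨refl ⟩
        (η ∘ (id +₁ S.F₁ u)) ∘ i₂ ∘ S.F₁ i₂   ≈⟨ assoc ⟩
        η ∘ (id +₁ S.F₁ u) ∘ i₂ ∘ S.F₁ i₂     ≈⟨ refl⟩∘⟨ Eq.sym assoc ⟩
        η ∘ ((id +₁ S.F₁ u) ∘ i₂) ∘ S.F₁ i₂   ≈⟨ refl⟩∘⟨ (inject₂ ⟩∘⟨refl) ⟩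
        η ∘ (i₂ ∘ S.F₁ u) ∘ S.F₁ i₂           ≈⟨ refl⟩∘⟨ assoc ⟩
        η ∘ i₂ ∘ S.F₁ u ∘ S.F₁ i₂             ≈⟨ refl⟩∘⟨ (refl⟩∘⟨ Eq.sym S.homomorphism) ⟩
        η ∘ i₂ ∘ S.F₁ (u ∘ i₂)                ∎

  out-natural : OutNatural
  out-natural f = begin
    out ∘ TΣ₁ f                                  ≈⟨ ‡-equation (ηᵛ ∘ f) ⟩
    [ out ∘ ηᵛ ∘ f , η ∘ i₂ ∘ S.F₁ (TΣ₁ f) ] * ∘ out ≈⟨ *-resp-≈ ([]-cong pure-left Eq.refl) ⟩∘⟨refl ⟩
    [ η ∘ i₁ ∘ f , η ∘ i₂ ∘ S.F₁ (TΣ₁ f) ] * ∘ out   ≈⟨ *-resp-≈ (Eq.sym ∘-[]) ⟩∘⟨refl ⟩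
    K₁ f (TΣ₁ f) ∘ out                           ∎
    where
      pure-left : out ∘ ηᵛ ∘ f ≈ η ∘ i₁ ∘ f
      pure-left = Eq.trans (Eq.sym assoc) (Eq.trans (out∘ηᵛ ⟩∘⟨refl) assoc)

  TΣ₁-unique : ∀ {X Y} {f : X ⇒ Y} {h : TΣ₀ X ⇒ TΣ₀ Y} →
               CoalgebraMorphism out f out h → h ≈ TΣ₁ f
  TΣ₁-unique {f = f} oh =
    Eq.trans (morphism-unique oh) (Eq.sym (morphism-unique (out-natural f)))

  TΣ-functor : IsFunctor category category TΣ₀ TΣ₁
  TΣ-functor = record
    { identity     = Eq.sym (TΣ₁-unique morphism-id)
    ; homomorphism = λ {_} {_} {_} {f} {g} →
                       Eq.sym (TΣ₁-unique (morphism-∘ (out-natural g) (out-natural f)))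
    ; F-resp-≈     = λ {_} {_} {f} p → TΣ₁-unique (morphism-resp p (out-natural f))
    }

  unfold-reindex : ∀ {X Y A} (a : A ⇒ T₀ (X + S.F₀ A)) (f : X ⇒ Y) →
                   TΣ₁ f ∘ unfold a ≈ unfold (K₁ f id ∘ a)
  unfold-reindex a f =
    morphism-unique (morphism-resp identityʳ (morphism-∘ (out-natural f) unfold-commute))

  module Pointwise {o′ ℓ′ e′} (B : Category o′ ℓ′ e′) (G : Functor B category) where
    private module B = Category B
    private module G = Functor G

    TΣG-functor : IsFunctor B category (TΣG₀ B G) (TΣG₁ B G)
    TΣG-functor = ∘-isFunctor G TΣ-functor

    -- The componentwise unfolds of a coalgebra in [B, C] are natural: F k is a
    -- coalgebra morphism over G k, so fusion and reindexing apply.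
    unfold-natural : (A : Coalgebraᴳ B G) →
                     IsNatural B category (Functor.F₀ (Coalgebraᴳ.F A))
                       (Functor.F₁ (Coalgebraᴳ.F A)) (TΣG₀ B G) (TΣG₁ B G)
                       (λ b → unfold (Coalgebraᴳ.α A b))
    unfold-natural A {a} {b} k = begin
      unfold (α b) ∘ F.F₁ k           ≈⟨ unfold-fusion (morphism-rebase (α-natural k)) ⟩
      unfold (K₁ (G.F₁ k) id ∘ α a)   ≈⟨ Eq.sym (unfold-reindex (α a) (G.F₁ k)) ⟩
      TΣ₁ (G.F₁ k) ∘ unfold (α a)     ∎
      where
        open Coalgebraᴳ A
        module F = Functor F

    final : IsFinalCoalgebraᴳ B G TΣG-functor
    final = record
      { outG-natural    = λ k → out-natural (G.F₁ k)
      ; unfoldᴳ         = λ A b → unfold (Coalgebraᴳ.α A b)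
      ; unfoldᴳ-natural = unfold-natural
      ; unfoldᴳ-commute = λ A b → unfold-commute
      ; unfoldᴳ-unique  = λ A h _ commutes b → unfold-unique (commutes b)
      }

lemma4p4 : ∀ {o ℓ e o′ ℓ′ e′}
           (C : DistributiveCategory o ℓ e) (𝕋 : StrongMonad C) (𝕊 : StrongFunctor C)
           (ν : FinalCoalgebras C 𝕋 𝕊) →
           Σ[ TΣ-functor ∈ IsFunctor (DistributiveCategory.category C)
                                     (DistributiveCategory.category C)
                                     (FinalCoalgebras.TΣ₀ ν)
                                     (Construction.TΣ₁ C 𝕋 𝕊 ν) ]
             (Construction.OutNatural C 𝕋 𝕊 ν
              × ((B : Category o′ ℓ′ e′) (G : Functor B (DistributiveCategory.category C)) →
                 Σ[ TΣG-functor ∈ IsFunctor B (DistributiveCategory.category C)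
                                    (Construction.TΣG₀ C 𝕋 𝕊 ν B G)
                                    (Construction.TΣG₁ C 𝕋 𝕊 ν B G) ]
                   Construction.IsFinalCoalgebraᴳ C 𝕋 𝕊 ν B G TΣG-functor))
lemma4p4 C 𝕋 𝕊 ν =
  TΣ-functor , out-natural , λ B G → Pointwise.TΣG-functor B G , Pointwise.final B G
  where open Proof C 𝕋 𝕊 ν
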